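{- Let $\mathrm{H}$ be a finite group and $\sigma\in\mathrm{Aut}(\mathrm{H})$ with $\sigma^2=\mathrm{Id}$. If $|\mathrm{H}|=2^k m$ with $k\in\mathbb{Z}_{\ge0}$ and $m$ odd, then $\mathcal{G}_{\mathrm{TF}}(\mathrm{H},\sigma)\le 2^k$.
   Context: $\mathbb{Z}_2=\{e,x\}$, $\mathrm{H}\rtimes_\theta\mathbb{Z}_2$ is the semidirect product with $\theta(x)=\sigma$ (so $xhx=\sigma(h)$), $\mathrm{H}$ is identified with $\mathrm{H}\times\{e\}$; $S(\mathrm{H},\sigma)$ is the set of $g\in\mathrm{H}\rtimes_\theta\mathbb{Z}_2$ with $g\notin\mathrm{H}$ and $g^2=e$; $\mathcal{G}_{\mathrm{TF}}(\mathrm{H},\sigma)$ is the number of conjugacy classes of $\mathrm{H}\rtimes_\theta\mathbb{Z}_2$ contained in $S(\mathrm{H},\sigma)$. -}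

module Defs where

open import Level using (0ℓ)
open import Data.Nat using (ℕ)
open import Data.Bool using (Bool; true; false; _xor_; if_then_else_)
open import Data.Fin using (Fin)
open import Data.Fin.Properties using (any?) renaming (_≟_ to _≟ᶠ_)
open import Data.Product using (_×_; _,_; Σ; ∃)
open import Data.Product.Properties using (≡-dec)
open import Data.List using (List; []; _∷_; length; filter; map; concatMap; allFin)
import Data.Bool.Properties as BoolP
open import Relation.Binary.PropositionalEquality using (_≡_)
open import Relation.Nullary using (Dec; does; yes; no)
open import Relation.Nullary.Decidable using (_×-dec_)
open import Algebra.Bundles.Raw using (RawGroup)
open import Algebra.Structures using (IsGroup)
open import Algebra.Morphism.Structures using (module GroupMorphisms)

-- A finite group of order n, represented on the carrier Fin n
-- (every finite group of order n is isomorphic to one of this form).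
record FinGroup (n : ℕ) : Set where
  infixl 7 _∙_
  field
    _∙_     : Fin n → Fin n → Fin n
    ε       : Fin n
    _⁻¹     : Fin n → Fin n
    isGroup : IsGroup _≡_ _∙_ ε _⁻¹

  rawGroup : RawGroup 0ℓ 0ℓ
  rawGroup = record { Carrier = Fin n ; _≈_ = _≡_ ; _∙_ = _∙_ ; ε = ε ; _⁻¹ = _⁻¹ }

IsAutomorphism : ∀ {n} (H : FinGroup n) → (Fin n → Fin n) → Set
IsAutomorphism H σ = GroupMorphisms.IsGroupIsomorphism (FinGroup.rawGroup H) (FinGroup.rawGroup H) σ

-- An element (h , b) stands for h x^b  (b = false: h ∈ H ; b = true: h x).
-- Since x h = σ(h) x, we get (h₁ x^a)(h₂ x^b) = h₁ σ^a(h₂) x^(a+b).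
module SemidirectZ2 {n : ℕ} (H : FinGroup n) (σ : Fin n → Fin n) where
  open FinGroup H

  SD : Set
  SD = Fin n × Bool

  σ^ : Bool → Fin n → Fin n
  σ^ false h = h
  σ^ true  h = σ h

  _·_ : SD → SD → SD
  (h₁ , a) · (h₂ , b) = (h₁ ∙ σ^ a h₂ , a xor b)

  e : SD
  e = (ε , false)

  -- inverse of h x^a is σ^a(h⁻¹) x^a (using σ² = Id)
  inv : SD → SD
  inv (h , a) = (σ^ a (h ⁻¹) , a)

  _≟_ : (g g′ : SD) → Dec (g ≡ g′)
  _≟_ = ≡-dec _≟ᶠ_ BoolP._≟_

  InH : SD → Set
  InH (h , b) = b ≡ false

  InS : SD → Set
  InS g = (g .Data.Product.proj₂ ≡ true) × ((g · g) ≡ e)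

  inS? : (g : SD) → Dec (InS g)
  inS? g = (g .Data.Product.proj₂ BoolP.≟ true) ×-dec ((g · g) ≟ e)

  Conj : SD → SD → Set
  Conj g g′ = ∃ λ (k : SD) → ((k · g) · inv k) ≡ g′

  conj? : (g g′ : SD) → Dec (Conj g g′)
  conj? g g′ with any? (λ h → (((h , false) · g) · inv (h , false)) ≟ g′)
                | any? (λ h → (((h , true) · g) · inv (h , true)) ≟ g′)
  ... | yes (h , p) | _ = yes ((h , false) , p)
  ... | no _ | yes (h , p) = yes ((h , true) , p)
  ... | no ¬p | no ¬q = no λ { ((h , false) , r) → ¬p (h , r) ; ((h , true) , r) → ¬q (h , r) }

  elements : List SD
  elements = concatMap (λ h → (h , false) ∷ (h , true) ∷ []) (allFin n)

  anyConj : SD → List SD → Bool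
  anyConj g [] = false
  anyConj g (r ∷ rs) = if does (conj? r g) then true else anyConj g rs

  reps : List SD → List SD
  reps [] = []
  reps (g ∷ gs) = let r = reps gs in if anyConj g r then r else g ∷ r

  -- G_TF(H,σ): number of conjugacy classes of H ⋊ Z₂ contained in S(H,σ).
  -- S(H,σ) is a union of conjugacy classes, so this is the number of
  -- conjugacy classes of elements of S(H,σ).
  GTF : ℕ
  GTF = length (reps (filter inS? elements))

GTF : ∀ {n} (H : FinGroup n) (σ : Fin n → Fin n) → ℕ
GTF H σ = SemidirectZ2.GTF H σ

-- G = H ⋊ ℤ₂ has order 2^(k+1) m with m odd, so the number C(2^(k+1) m, 2^(k+1)) of its
-- 2^(k+1)-element subsets is odd (Lucas).  If every such subset A admitted an involution
-- fixing no translate of A, translating by the first such involution (which depends only on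
-- the orbit of A) would pair these subsets off; hence some A has the property that every
-- involution fixes a translate gA, i.e. is conjugate into the stabilizer P of A.  Now
-- |P| ≤ |A| = 2^(k+1), at most half of P lies outside H, and sending each conjugacy class
-- in S(H,σ) to a conjugate in P ∖ H is injective; so there are at most 2^k such classes.

module Submission where

open import Defs
open import Algebra.Bundles using (Group)
open import Algebra.Morphism.Structures using (module GroupMorphisms)
import Algebra.Properties.Group as GroupProperties
open import Algebra.Structures using (IsGroup)
open import Data.Bool using (Bool; true; false; _xor_)
import Data.Bool.Properties as Bool
open import Data.Empty using (⊥)
open import Data.Fin using (Fin; zero; suc)
import Data.Fin.Properties as Fin
open import Data.Fin.Subset using (Subset; ∣_∣)
open import Data.List using (List; []; _∷_; _++_; length; map; filter; find; allFin)
open import Data.List.Membership.Propositional using (_∈_; lose) renaming (find to ∈-find)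
open import Data.List.Membership.Propositional.Properties
  using (∈-allFin; ∈-filter⁺; ∈-filter⁻; ∈-map⁺; ∈-map⁻; ∈-++⁺ˡ; ∈-++⁺ʳ; ∈-++⁻)
open import Data.List.Properties using (length-map; length-++; filter-notAll; filter-all; filter-reject)
open import Data.List.Relation.Binary.Disjoint.Propositional using (Disjoint)
open import Data.List.Relation.Binary.Subset.Propositional using (_⊆_)
open import Data.List.Relation.Unary.All using (All; []; _∷_)
import Data.List.Relation.Unary.All as All
import Data.List.Relation.Unary.All.Properties as All
open import Data.List.Relation.Unary.AllPairs using (AllPairs; []; _∷_)
import Data.List.Relation.Unary.AllPairs as AllPairs
open import Data.List.Relation.Unary.Any using (here; there; any?)
import Data.List.Relation.Unary.Any as Any
open import Data.List.Relation.Unary.Unique.Propositional using (Unique)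
import Data.List.Relation.Unary.Unique.Propositional.Properties as Unique
open import Data.Maybe using (Maybe; just; nothing; maybe′)
import Data.Maybe.Properties as Maybe
open import Data.Nat using (ℕ; zero; suc; _+_; _*_; _^_; _≤_; _<_; z≤n; s≤s; parity)
open import Data.Nat.Combinatorics using (_C_; nC1≡n; nCk+nC[k+1]≡[n+1]C[k+1])
open import Data.Nat.Divisibility using (_∣_; divides; ∣m∣n⇒∣m+n; ∣-refl)
open import Data.Nat.Properties
  using (≤-refl; ≤-trans; ≤-antisym; <-trans; <⇒≢; suc-injective;
         +-identityʳ; *-identityˡ; *-comm; *-assoc; *-suc; *-cancelˡ-≤; m^n>0)
open import Data.Parity.Base using (0ℙ; 1ℙ) renaming (_+_ to _ℙ+_)
import Data.Parity.Properties as ℙ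
open import Data.Product using (∃-syntax; _×_; _,_; proj₁; proj₂)
import Data.Product as Product
open import Data.Product.Function.NonDependent.Propositional using (_×-↔_)
open import Data.Sum using (inj₁; inj₂)
open import Data.Vec using ([]; _∷_; lookup; tabulate)
import Data.Vec.Properties as Vec
open import Function using (_∘_; id)
open import Function.Bundles using (Inverse; _↔_)
open import Function.Construct.Composition using (_↔-∘_)
open import Function.Construct.Identity using (↔-id)
open import Function.Construct.Symmetry using (↔-sym)
open import Function.Definitions using (Injective)
open import Level using (0ℓ)
open import Relation.Binary.Definitions using (DecidableEquality)
open import Relation.Binary.PropositionalEquality
  using (_≡_; _≢_; refl; sym; trans; cong; cong₂; subst; subst₂; isEquivalence; module ≡-Reasoning)
open import Relation.Nullary using (¬_; Dec; yes; no; ¬?; contradiction; _×-dec_)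
open import Relation.Nullary.Decidable using (decidable-stable)
import Relation.Nullary.Decidable as Dec
open import Relation.Unary using (Decidable)

open ≡-Reasoning

-- Counting in lists

module _ {A : Set} (_≟_ : DecidableEquality A) where

  without : A → List A → List A
  without y = filter (¬? ∘ (y ≟_))

  ∈-without⁺ : ∀ {y z xs} → z ∈ xs → y ≢ z → z ∈ without y xs
  ∈-without⁺ = ∈-filter⁺ (¬? ∘ (_ ≟_))

  ∈-without⁻ : ∀ {y z xs} → z ∈ without y xs → z ∈ xs × y ≢ z
  ∈-without⁻ = ∈-filter⁻ (¬? ∘ (_ ≟_))

  length-without< : ∀ {y xs} → y ∈ xs → length (without y xs) < length xs
  length-without< {y} {xs} y∈xs = filter-notAll (¬? ∘ (y ≟_)) xs (Any.map (λ y≡z y≢z → y≢z y≡z) y∈xs)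

  length-without : ∀ {y xs} → Unique xs → y ∈ xs → length xs ≡ suc (length (without y xs))
  length-without {xs = x ∷ xs} (x∉xs ∷ _) (here refl)
    rewrite filter-reject (¬? ∘ (x ≟_)) {xs = xs} (λ x≢x → x≢x refl)
          | filter-all (¬? ∘ (x ≟_)) x∉xs = refl
  length-without {y} {x ∷ xs} (x∉xs ∷ xs-unique) (there y∈xs) with y ≟ x
  ... | yes refl = contradiction refl (All.lookup x∉xs y∈xs)
  ... | no _     = cong suc (length-without xs-unique y∈xs)

module _ {A B : Set} (_≟_ : DecidableEquality B) where

  injectiveRel⇒length≤ : (R : A → B → Set) {xs : List A} {ys : List B} →
    AllPairs (λ x x′ → ∀ {y} → R x y → R x′ y → ⊥) xs →
    (∀ {x} → x ∈ xs → ∃[ y ] y ∈ ys × R x y) →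
    length xs ≤ length ys
  injectiveRel⇒length≤ R {[]} [] _ = z≤n
  injectiveRel⇒length≤ R {x ∷ xs} {ys} (apart ∷ xs-apart) related
    with y , y∈ys , Rxy ← related (here refl)
    = ≤-trans (s≤s (injectiveRel⇒length≤ R xs-apart related′)) (length-without< _≟_ y∈ys)
    where
    related′ : ∀ {x′} → x′ ∈ xs → ∃[ y′ ] y′ ∈ without _≟_ y ys × R x′ y′
    related′ x′∈xs with y′ , y′∈ys , Rx′y′ ← related (there x′∈xs)
      = y′ , ∈-without⁺ _≟_ y′∈ys (λ { refl → All.lookup apart x′∈xs Rxy Rx′y′ }) , Rx′y′

  injective⇒length≤ : (f : A → B) → Injective _≡_ _≡_ f → {xs : List A} {ys : List B} →
    Unique xs → (∀ {x} → x ∈ xs → f x ∈ ys) → length xs ≤ length ys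
  injective⇒length≤ f f-injective xs-unique f[xs]⊆ys =
    injectiveRel⇒length≤ (λ x y → f x ≡ y)
      (AllPairs.map (λ x≢x′ {y} fx≡y fx′≡y → x≢x′ (f-injective (trans fx≡y (sym fx′≡y)))) xs-unique)
      (λ x∈xs → _ , f[xs]⊆ys x∈xs , refl)

module _ {A : Set} (_≟_ : DecidableEquality A) (f : A → A) where

  fixedPointFreeInvolution⇒even : ∀ {xs} → Unique xs →
    (∀ {x} → x ∈ xs → f x ∈ xs) → (∀ {x} → x ∈ xs → f (f x) ≡ x) → (∀ {x} → x ∈ xs → f x ≢ x) →
    parity (length xs) ≡ 0ℙ
  fixedPointFreeInvolution⇒even {xs} = go (suc (length xs)) ≤-refl
    where
    go : ∀ n {xs} → length xs < n → Unique xs →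
      (∀ {x} → x ∈ xs → f x ∈ xs) → (∀ {x} → x ∈ xs → f (f x) ≡ x) → (∀ {x} → x ∈ xs → f x ≢ x) →
      parity (length xs) ≡ 0ℙ
    go n {[]} _ _ _ _ _ = refl
    go (suc n) {x ∷ rest} (s≤s bound) (x∉rest ∷ rest-unique) closed involutive moves =
      trans (cong (parity ∘ suc) (length-without _≟_ rest-unique fx∈rest))
        (go n (<-trans (length-without< _≟_ fx∈rest) bound) (Unique.filter⁺ _ rest-unique)
          closed′ (involutive ∘ there ∘ proj₁ ∘ ∈-without⁻ _≟_) (moves ∘ there ∘ proj₁ ∘ ∈-without⁻ _≟_))
      where
      fx∈rest : f x ∈ rest
      fx∈rest with closed (here refl)
      ... | here fx≡x = contradiction fx≡x (moves (here refl))
      ... | there fx∈rest = fx∈rest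
      closed′ : ∀ {z} → z ∈ without _≟_ (f x) rest → f z ∈ without _≟_ (f x) rest
      closed′ z∈rest′ with z∈rest , fx≢z ← ∈-without⁻ _≟_ z∈rest′ with closed (there z∈rest)
      ... | here fz≡x = contradiction (trans (cong f (sym fz≡x)) (involutive (there z∈rest))) fx≢z
      ... | there fz∈rest = ∈-without⁺ _≟_ fz∈rest λ fx≡fz →
        All.lookup x∉rest z∈rest
          (trans (sym (involutive (here refl))) (trans (cong f fx≡fz) (involutive (there z∈rest))))

module _ {A : Set} {P Q : A → Set} where

  find-cong : (P? : Decidable P) (Q? : Decidable Q) →
    (∀ x → P x → Q x) → (∀ x → Q x → P x) → ∀ xs → find P? xs ≡ find Q? xs
  find-cong P? Q? P⇒Q Q⇒P [] = refl
  find-cong P? Q? P⇒Q Q⇒P (x ∷ xs) with P? x | Q? x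
  ... | yes _  | yes _  = refl
  ... | yes px | no ¬qx = contradiction (P⇒Q x px) ¬qx
  ... | no ¬px | yes qx = contradiction (Q⇒P x qx) ¬px
  ... | no _   | no _   = find-cong P? Q? P⇒Q Q⇒P xs

module _ {A : Set} {P : A → Set} (P? : Decidable P) where

  find-just : ∀ xs {x} → find P? xs ≡ just x → P x
  find-just (y ∷ xs) found with P? y
  find-just (y ∷ xs) refl | yes py = py
  ... | no _ = find-just xs found

  find-nothing : ∀ xs → find P? xs ≡ nothing → All (¬_ ∘ P) xs
  find-nothing [] _ = []
  find-nothing (y ∷ xs) none with P? y
  find-nothing (y ∷ xs) () | yes _
  ... | no ¬py = ¬py ∷ find-nothing xs none

-- Parity of binomial coefficients

parity-pascal : ∀ n k → parity (suc n C suc k) ≡ parity (n C k) ℙ+ parity (n C suc k)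
parity-pascal n k = trans (cong parity (sym (nCk+nC[k+1]≡[n+1]C[k+1] n k))) (ℙ.+-homo-+ (n C k) _)

parity-C-double : ∀ n j →
  parity (2 * n C 2 * j) ≡ parity (n C j) × parity (2 * n C suc (2 * j)) ≡ 0ℙ
parity-C-double zero    zero    = refl , refl
parity-C-double zero    (suc j) = refl , refl
parity-C-double (suc n) j =
  subst (λ M → parity (M C 2 * j) ≡ parity (suc n C j) × parity (M C suc (2 * j)) ≡ 0ℙ)
        (sym (*-suc 2 n)) (even j , odd j)
  where
  D = 2 * n
  ih : ∀ j → parity (D C 2 * j) ≡ parity (n C j) × parity (D C suc (2 * j)) ≡ 0ℙ
  ih = parity-C-double n
  ih₊ : ∀ j → parity (D C (2 + 2 * j)) ≡ parity (n C suc j) × parity (D C (3 + 2 * j)) ≡ 0ℙ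
  ih₊ j = subst (λ J → parity (D C J) ≡ parity (n C suc j) × parity (D C suc J) ≡ 0ℙ)
                (*-suc 2 j) (ih (suc j))
  even : ∀ j → parity ((2 + D) C 2 * j) ≡ parity (suc n C j)
  even zero    = refl
  even (suc j) = begin
    parity ((2 + D) C 2 * suc j)
      ≡⟨ cong (λ i → parity ((2 + D) C i)) (*-suc 2 j) ⟩
    parity ((2 + D) C (2 + J))
      ≡⟨ parity-pascal (1 + D) (1 + J) ⟩
    parity ((1 + D) C (1 + J)) ℙ+ parity ((1 + D) C (2 + J))
      ≡⟨ cong₂ _ℙ+_ (parity-pascal D J) (parity-pascal D (1 + J)) ⟩
    (parity (D C J) ℙ+ parity (D C (1 + J))) ℙ+ (parity (D C (1 + J)) ℙ+ parity (D C (2 + J)))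
      ≡⟨ cong₂ (λ p q → (p ℙ+ q) ℙ+ (q ℙ+ parity (D C (2 + J)))) (proj₁ (ih j)) (proj₂ (ih j)) ⟩
    (parity (n C j) ℙ+ 0ℙ) ℙ+ parity (D C (2 + J))
      ≡⟨ cong₂ _ℙ+_ (ℙ.+-identityʳ (parity (n C j))) (proj₁ (ih₊ j)) ⟩
    parity (n C j) ℙ+ parity (n C suc j)
      ≡⟨ parity-pascal n j ⟨
    parity (suc n C suc j)
      ∎
    where J = 2 * j
  odd : ∀ j → parity ((2 + D) C suc (2 * j)) ≡ 0ℙ
  odd zero    = trans (cong parity (nC1≡n (2 + D))) (ℙ.*-homo-* 2 n)
  odd (suc j) = begin
    parity ((2 + D) C suc (2 * suc j))
      ≡⟨ cong (λ i → parity ((2 + D) C suc i)) (*-suc 2 j) ⟩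
    parity ((2 + D) C (3 + J))
      ≡⟨ parity-pascal (1 + D) (2 + J) ⟩
    parity ((1 + D) C (2 + J)) ℙ+ parity ((1 + D) C (3 + J))
      ≡⟨ cong₂ _ℙ+_ (parity-pascal D (1 + J)) (parity-pascal D (2 + J)) ⟩
    (parity (D C (1 + J)) ℙ+ p) ℙ+ (p ℙ+ parity (D C (3 + J)))
      ≡⟨ cong₂ (λ q r → (q ℙ+ p) ℙ+ (p ℙ+ r)) (proj₂ (ih j)) (proj₂ (ih₊ j)) ⟩
    p ℙ+ (p ℙ+ 0ℙ)
      ≡⟨ cong (p ℙ+_) (ℙ.+-identityʳ p) ⟩
    p ℙ+ p
      ≡⟨ ℙ.p+p≡0ℙ p ⟩
    0ℙ
      ∎
    where
    J = 2 * j
    p = parity (D C (2 + J))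

parity-C-powerOfTwo : ∀ a m → parity (2 ^ a * m C 2 ^ a) ≡ parity m
parity-C-powerOfTwo zero    m = trans (cong parity (nC1≡n (1 * m))) (cong parity (*-identityˡ m))
parity-C-powerOfTwo (suc a) m = begin
  parity (2 * 2 ^ a * m C 2 * 2 ^ a)   ≡⟨ cong (λ N → parity (N C 2 * 2 ^ a)) (*-assoc 2 (2 ^ a) m) ⟩
  parity (2 * (2 ^ a * m) C 2 * 2 ^ a) ≡⟨ proj₁ (parity-C-double (2 ^ a * m) (2 ^ a)) ⟩
  parity (2 ^ a * m C 2 ^ a)           ≡⟨ parity-C-powerOfTwo a m ⟩
  parity m                             ∎

¬2∣⇒parity≡1ℙ : ∀ m → ¬ 2 ∣ m → parity m ≡ 1ℙ
¬2∣⇒parity≡1ℙ zero          2∤m = contradiction (divides 0 refl) 2∤m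
¬2∣⇒parity≡1ℙ (suc zero)    2∤m = refl
¬2∣⇒parity≡1ℙ (suc (suc m)) 2∤m = ¬2∣⇒parity≡1ℙ m (2∤m ∘ ∣m∣n⇒∣m+n ∣-refl)

-- Subsets of a given size

members : ∀ {N} → Subset N → List (Fin N)
members []          = []
members (true  ∷ U) = zero ∷ map suc (members U)
members (false ∷ U) = map suc (members U)

length-members : ∀ {N} (U : Subset N) → length (members U) ≡ ∣ U ∣
length-members []          = refl
length-members (true  ∷ U) = cong suc (trans (length-map suc (members U)) (length-members U))
length-members (false ∷ U) = trans (length-map suc (members U)) (length-members U)

∈-members⁺ : ∀ {N} (U : Subset N) {i} → lookup U i ≡ true → i ∈ members U
∈-members⁺ (true  ∷ U) {zero}  _   = here refl
∈-members⁺ (true  ∷ U) {suc i} U[i] = there (∈-map⁺ suc (∈-members⁺ U U[i]))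
∈-members⁺ (false ∷ U) {suc i} U[i] = ∈-map⁺ suc (∈-members⁺ U U[i])

∈-members⁻ : ∀ {N} (U : Subset N) {i} → i ∈ members U → lookup U i ≡ true
∈-members⁻ (true ∷ U) (here refl) = refl
∈-members⁻ (true ∷ U) (there i∈U) with j , j∈U , refl ← ∈-map⁻ suc i∈U = ∈-members⁻ U j∈U
∈-members⁻ (false ∷ U) i∈U with j , j∈U , refl ← ∈-map⁻ suc i∈U = ∈-members⁻ U j∈U

members-unique : ∀ {N} (U : Subset N) → Unique (members U)
members-unique []          = []
members-unique (true  ∷ U) =
  All.map⁺ (All.universal (λ _ ()) (members U)) ∷ Unique.map⁺ Fin.suc-injective (members-unique U)
members-unique (false ∷ U) = Unique.map⁺ Fin.suc-injective (members-unique U)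

∃-∈-members : ∀ {N} (U : Subset N) → 0 < ∣ U ∣ → ∃[ i ] i ∈ members U
∃-∈-members U 0<∣U∣ with members U | length-members U
... | []    | 0≡∣U∣ = contradiction 0≡∣U∣ (<⇒≢ 0<∣U∣)
... | i ∷ _ | _     = i , here refl

subsetsOfSize : (N s : ℕ) → List (Subset N)
subsetsOfSize zero    zero    = [] ∷ []
subsetsOfSize zero    (suc s) = []
subsetsOfSize (suc N) zero    = map (false ∷_) (subsetsOfSize N zero)
subsetsOfSize (suc N) (suc s) = map (true ∷_) (subsetsOfSize N s) ++ map (false ∷_) (subsetsOfSize N (suc s))

length-subsetsOfSize : ∀ N s → length (subsetsOfSize N s) ≡ N C s
length-subsetsOfSize zero    zero    = refl
length-subsetsOfSize zero    (suc s) = refl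
length-subsetsOfSize (suc N) zero    =
  trans (length-map (false ∷_) (subsetsOfSize N zero)) (length-subsetsOfSize N zero)
length-subsetsOfSize (suc N) (suc s) = begin
  length (map (true ∷_) (subsetsOfSize N s) ++ map (false ∷_) (subsetsOfSize N (suc s)))
    ≡⟨ length-++ (map (true ∷_) (subsetsOfSize N s)) ⟩
  length (map (true ∷_) (subsetsOfSize N s)) + length (map (false ∷_) (subsetsOfSize N (suc s)))
    ≡⟨ cong₂ _+_ (length-map (true ∷_) (subsetsOfSize N s)) (length-map (false ∷_) (subsetsOfSize N (suc s))) ⟩
  length (subsetsOfSize N s) + length (subsetsOfSize N (suc s))
    ≡⟨ cong₂ _+_ (length-subsetsOfSize N s) (length-subsetsOfSize N (suc s)) ⟩
  N C s + N C suc s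
    ≡⟨ nCk+nC[k+1]≡[n+1]C[k+1] N s ⟩
  suc N C suc s
    ∎

∈-subsetsOfSize⁺ : ∀ {N s} (U : Subset N) → ∣ U ∣ ≡ s → U ∈ subsetsOfSize N s
∈-subsetsOfSize⁺ {s = zero}  []          _    = here refl
∈-subsetsOfSize⁺ {s = suc s} (true  ∷ U) size = ∈-++⁺ˡ (∈-map⁺ (true ∷_) (∈-subsetsOfSize⁺ U (suc-injective size)))
∈-subsetsOfSize⁺ {s = zero}  (false ∷ U) size = ∈-map⁺ (false ∷_) (∈-subsetsOfSize⁺ U size)
∈-subsetsOfSize⁺ {s = suc s} (false ∷ U) size = ∈-++⁺ʳ _ (∈-map⁺ (false ∷_) (∈-subsetsOfSize⁺ U size))

∈-subsetsOfSize⁻ : ∀ {N s} {U : Subset N} → U ∈ subsetsOfSize N s → ∣ U ∣ ≡ s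
∈-subsetsOfSize⁻ {zero}  {zero}  (here refl) = refl
∈-subsetsOfSize⁻ {suc N} {zero}  U∈ with D , D∈ , refl ← ∈-map⁻ (false ∷_) U∈ = ∈-subsetsOfSize⁻ D∈
∈-subsetsOfSize⁻ {suc N} {suc s} U∈ with ∈-++⁻ (map (true ∷_) (subsetsOfSize N s)) U∈
... | inj₁ U∈ˡ with D , D∈ , refl ← ∈-map⁻ (true ∷_) U∈ˡ = cong suc (∈-subsetsOfSize⁻ D∈)
... | inj₂ U∈ʳ with D , D∈ , refl ← ∈-map⁻ (false ∷_) U∈ʳ = ∈-subsetsOfSize⁻ D∈

subsetsOfSize-unique : ∀ N s → Unique (subsetsOfSize N s)
subsetsOfSize-unique zero    zero    = [] ∷ []
subsetsOfSize-unique zero    (suc s) = []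
subsetsOfSize-unique (suc N) zero    = Unique.map⁺ Vec.∷-injectiveʳ (subsetsOfSize-unique N zero)
subsetsOfSize-unique (suc N) (suc s) =
  Unique.++⁺ (Unique.map⁺ Vec.∷-injectiveʳ (subsetsOfSize-unique N s))
             (Unique.map⁺ Vec.∷-injectiveʳ (subsetsOfSize-unique N (suc s)))
             headsDiffer
  where
  headsDiffer : Disjoint (map (true ∷_) (subsetsOfSize N s)) (map (false ∷_) (subsetsOfSize N (suc s)))
  headsDiffer (U∈ˡ , U∈ʳ) with _ , _ , refl ← ∈-map⁻ (true ∷_) U∈ˡ with _ , _ , () ← ∈-map⁻ (false ∷_) U∈ʳ

parity-length-subsetsOfSize : ∀ a m → parity (length (subsetsOfSize (2 ^ a * m) (2 ^ a))) ≡ parity m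
parity-length-subsetsOfSize a m =
  trans (cong parity (length-subsetsOfSize (2 ^ a * m) (2 ^ a))) (parity-C-powerOfTwo a m)

-- Finite groups acting on their subsets

module FiniteGroup {X : Set} {mul : X → X → X} {unit : X} {inv : X → X}
  (isGroup : IsGroup _≡_ mul unit inv) (_≟_ : DecidableEquality X)
  {N : ℕ} (enumeration : X ↔ Fin N) where

  group : Group 0ℓ 0ℓ
  group = record { Carrier = X ; _≈_ = _≡_ ; _∙_ = mul ; ε = unit ; _⁻¹ = inv ; isGroup = isGroup }

  open Group group using (_∙_; ε; _⁻¹; assoc; identityˡ; inverseˡ)
  open GroupProperties group
    using (∙-cancelˡ; ∙-cancelʳ; ⁻¹-anti-homo-∙; ε⁻¹≈ε; \\-leftDividesˡ; \\-leftDividesʳ; //-rightDividesʳ)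
  open Inverse enumeration using (to; from; strictlyInverseˡ; strictlyInverseʳ)

  to-injective : Injective _≡_ _≡_ to
  to-injective {x} {y} tx≡ty = trans (sym (strictlyInverseʳ x)) (trans (cong from tx≡ty) (strictlyInverseʳ y))

  from-injective : Injective _≡_ _≡_ from
  from-injective {i} {j} fi≡fj = trans (sym (strictlyInverseˡ i)) (trans (cong to fi≡fj) (strictlyInverseˡ j))

  allElements : List X
  allElements = map from (allFin N)

  ∈-allElements : ∀ x → x ∈ allElements
  ∈-allElements x = subst (_∈ allElements) (strictlyInverseʳ x) (∈-map⁺ from (∈-allFin (to x)))

  allElements-unique : Unique allElements
  allElements-unique = Unique.map⁺ from-injective (Unique.allFin⁺ N)

  -- The translate gU, subsets of X being encoded as subsets of Fin N along the enumeration.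
  infixr 5 _•_
  _•_ : X → Subset N → Subset N
  g • U = tabulate (λ i → lookup U (to (g ⁻¹ ∙ from i)))

  lookup-• : ∀ g U x → lookup (g • U) (to x) ≡ lookup U (to (g ⁻¹ ∙ x))
  lookup-• g U x =
    trans (Vec.lookup∘tabulate _ (to x)) (cong (λ y → lookup U (to (g ⁻¹ ∙ y))) (strictlyInverseʳ x))

  •-∙ : ∀ g h U → (g ∙ h) • U ≡ g • h • U
  •-∙ g h U = Vec.tabulate-cong λ i → sym (begin
    lookup (h • U) (to (g ⁻¹ ∙ from i))     ≡⟨ lookup-• h U _ ⟩
    lookup U (to (h ⁻¹ ∙ (g ⁻¹ ∙ from i)))  ≡⟨ cong (lookup U ∘ to) (assoc (h ⁻¹) (g ⁻¹) (from i)) ⟨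
    lookup U (to ((h ⁻¹ ∙ g ⁻¹) ∙ from i))  ≡⟨ cong (λ y → lookup U (to (y ∙ from i))) (⁻¹-anti-homo-∙ g h) ⟨
    lookup U (to ((g ∙ h) ⁻¹ ∙ from i))     ∎)

  ε-• : ∀ U → ε • U ≡ U
  ε-• U = trans (Vec.tabulate-cong λ i → cong (lookup U) (begin
    to (ε ⁻¹ ∙ from i)  ≡⟨ cong (λ y → to (y ∙ from i)) ε⁻¹≈ε ⟩
    to (ε ∙ from i)     ≡⟨ cong to (identityˡ (from i)) ⟩
    to (from i)         ≡⟨ strictlyInverseˡ i ⟩
    i                   ∎)) (Vec.tabulate∘lookup U)

  ⁻¹-•-• : ∀ g U → g ⁻¹ • g • U ≡ U
  ⁻¹-•-• g U = trans (sym (•-∙ (g ⁻¹) g U)) (trans (cong (_• U) (inverseˡ g)) (ε-• U))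

  ∣•∣≤ : ∀ g U → ∣ g • U ∣ ≤ ∣ U ∣
  ∣•∣≤ g U = subst₂ _≤_ (length-members (g • U)) (length-members U)
    (injective⇒length≤ Fin._≟_ (λ i → to (g ⁻¹ ∙ from i))
      (λ same → from-injective (∙-cancelˡ (g ⁻¹) _ _ (to-injective same)))
      (members-unique (g • U))
      (λ {i} i∈gU → ∈-members⁺ U (trans (sym (Vec.lookup∘tabulate _ i)) (∈-members⁻ (g • U) i∈gU))))

  ∣•∣ : ∀ g U → ∣ g • U ∣ ≡ ∣ U ∣
  ∣•∣ g U = ≤-antisym (∣•∣≤ g U) (subst (λ V → ∣ V ∣ ≤ ∣ g • U ∣) (⁻¹-•-• g U) (∣•∣≤ (g ⁻¹) (g • U)))

  Conjugate : X → X → Set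
  Conjugate g g′ = ∃[ k ] k ∙ g ∙ k ⁻¹ ≡ g′

  conjugate-sym : ∀ {g g′} → Conjugate g g′ → Conjugate g′ g
  conjugate-sym {g} (k , refl) = k ⁻¹ , (begin
    k ⁻¹ ∙ (k ∙ g ∙ k ⁻¹) ∙ k ⁻¹ ⁻¹  ≡⟨ cong (_∙ k ⁻¹ ⁻¹) (assoc (k ⁻¹) (k ∙ g) (k ⁻¹)) ⟨
    k ⁻¹ ∙ (k ∙ g) ∙ k ⁻¹ ∙ k ⁻¹ ⁻¹  ≡⟨ cong (λ x → x ∙ k ⁻¹ ∙ k ⁻¹ ⁻¹) (\\-leftDividesʳ k g) ⟩
    g ∙ k ⁻¹ ∙ k ⁻¹ ⁻¹               ≡⟨ //-rightDividesʳ (k ⁻¹) g ⟩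
    g                                ∎)

  conjugate-trans : ∀ {g g′ g″} → Conjugate g g′ → Conjugate g′ g″ → Conjugate g g″
  conjugate-trans {g} (k , refl) (l , refl) = l ∙ k , (begin
    l ∙ k ∙ g ∙ (l ∙ k) ⁻¹           ≡⟨ cong (l ∙ k ∙ g ∙_) (⁻¹-anti-homo-∙ l k) ⟩
    l ∙ k ∙ g ∙ (k ⁻¹ ∙ l ⁻¹)        ≡⟨ assoc (l ∙ k ∙ g) (k ⁻¹) (l ⁻¹) ⟨
    l ∙ k ∙ g ∙ k ⁻¹ ∙ l ⁻¹          ≡⟨ cong (λ x → x ∙ k ⁻¹ ∙ l ⁻¹) (assoc l k g) ⟩
    l ∙ (k ∙ g) ∙ k ⁻¹ ∙ l ⁻¹        ≡⟨ cong (_∙ l ⁻¹) (assoc l (k ∙ g) (k ⁻¹)) ⟩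
    l ∙ (k ∙ g ∙ k ⁻¹) ∙ l ⁻¹        ∎)

  conjugate-⁻¹∙∙ : ∀ g t → Conjugate (g ⁻¹ ∙ (t ∙ g)) t
  conjugate-⁻¹∙∙ g t = g , (begin
    g ∙ (g ⁻¹ ∙ (t ∙ g)) ∙ g ⁻¹      ≡⟨ cong (_∙ g ⁻¹) (\\-leftDividesˡ g (t ∙ g)) ⟩
    t ∙ g ∙ g ⁻¹                     ≡⟨ //-rightDividesʳ g t ⟩
    t                                ∎)

  module OrbitsOfInvolutions {Y : Set} (_≟ʸ_ : DecidableEquality Y) (act : X → Y → Y)
    (act-∙ : ∀ g h y → act (g ∙ h) y ≡ act g (act h y)) (act-ε : ∀ y → act ε y ≡ y) where

    FixesOrbitPoint : X → Y → Set
    FixesOrbitPoint t y = ∃[ g ] act t (act g y) ≡ act g y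

    fixesOrbitPoint? : ∀ t y → Dec (FixesOrbitPoint t y)
    fixesOrbitPoint? t y =
      Dec.map′ (λ some → let g , _ , fixed = ∈-find some in g , fixed)
               (λ (g , fixed) → lose (∈-allElements g) fixed)
               (any? (λ g → act t (act g y) ≟ʸ act g y) allElements)

    fixesOrbitPoint-act⁻ : ∀ {t y} h → FixesOrbitPoint t (act h y) → FixesOrbitPoint t y
    fixesOrbitPoint-act⁻ {t} {y} h (g , fixed) = g ∙ h , subst (λ z → act t z ≡ z) (sym (act-∙ g h y)) fixed

    fixesOrbitPoint-act⁺ : ∀ {t y} h → FixesOrbitPoint t y → FixesOrbitPoint t (act h y)
    fixesOrbitPoint-act⁺ {t} {y} h fixes = fixesOrbitPoint-act⁻ (h ⁻¹) (subst (FixesOrbitPoint t) (sym back) fixes)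
      where
      back : act (h ⁻¹) (act h y) ≡ y
      back = trans (sym (act-∙ (h ⁻¹) h y)) (trans (cong (λ g → act g y) (inverseˡ h)) (act-ε y))

    OrbitFreeInvolution : Y → X → Set
    OrbitFreeInvolution y t = t ∙ t ≡ ε × ¬ FixesOrbitPoint t y

    orbitFreeInvolution? : ∀ y t → Dec (OrbitFreeInvolution y t)
    orbitFreeInvolution? y t = ((t ∙ t) ≟ ε) ×-dec ¬? (fixesOrbitPoint? t y)

    chosenInvolution : Y → Maybe X
    chosenInvolution y = find (orbitFreeInvolution? y) allElements

    chosenInvolution-act : ∀ h y → chosenInvolution (act h y) ≡ chosenInvolution y
    chosenInvolution-act h y = find-cong (orbitFreeInvolution? (act h y)) (orbitFreeInvolution? y)
      (λ _ → Product.map₂ (_∘ fixesOrbitPoint-act⁺ h)) (λ _ → Product.map₂ (_∘ fixesOrbitPoint-act⁻ h)) allElements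

    flip : Y → Y
    flip y = maybe′ (λ t → act t y) y (chosenInvolution y)

    involutionsFixOrbitPoints : ∀ {Ω} → Unique Ω → (∀ g {y} → y ∈ Ω → act g y ∈ Ω) →
      parity (length Ω) ≡ 1ℙ → ∃[ y ] y ∈ Ω × (∀ t → t ∙ t ≡ ε → FixesOrbitPoint t y)
    involutionsFixOrbitPoints {Ω} Ω-unique Ω-closed odd
      with any? (λ y → Maybe.≡-dec _≟_ (chosenInvolution y) nothing) Ω
    ... | yes unchosen with y , y∈Ω , none ← ∈-find unchosen =
      y , y∈Ω , λ t t∙t≡ε → decidable-stable (fixesOrbitPoint? t y)
        (λ ¬fixes → All.lookup (find-nothing (orbitFreeInvolution? y) allElements none)
                               (∈-allElements t) (t∙t≡ε , ¬fixes))
    ... | no allChosen =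
      contradiction (trans (sym odd) (fixedPointFreeInvolution⇒even _≟ʸ_ flip Ω-unique closed involutive moves)) λ ()
      where
      chosen : ∀ {y} → y ∈ Ω → ∃[ t ] chosenInvolution y ≡ just t
      chosen {y} y∈Ω with chosenInvolution y in eq
      ... | just t  = t , refl
      ... | nothing = contradiction (lose y∈Ω eq) allChosen
      closed : ∀ {y} → y ∈ Ω → flip y ∈ Ω
      closed {y} y∈Ω with t , eq ← chosen y∈Ω rewrite eq = Ω-closed t y∈Ω
      involutive : ∀ {y} → y ∈ Ω → flip (flip y) ≡ y
      involutive {y} y∈Ω with t , eq ← chosen y∈Ω = begin
        flip (flip y)      ≡⟨ cong flip (cong (maybe′ (λ t → act t y) y) eq) ⟩
        flip (act t y)     ≡⟨ cong (maybe′ (λ t′ → act t′ (act t y)) (act t y)) (trans (chosenInvolution-act t y) eq) ⟩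
        act t (act t y)    ≡⟨ act-∙ t t y ⟨
        act (t ∙ t) y      ≡⟨ cong (λ g → act g y) (proj₁ (find-just (orbitFreeInvolution? y) allElements eq)) ⟩
        act ε y            ≡⟨ act-ε y ⟩
        y                  ∎
      moves : ∀ {y} → y ∈ Ω → flip y ≢ y
      moves {y} y∈Ω fixed with t , eq ← chosen y∈Ω =
        proj₂ (find-just (orbitFreeInvolution? y) allElements eq)
          (ε , subst (λ z → act t z ≡ z) (sym (act-ε y)) (trans (cong (maybe′ (λ t → act t y) y) (sym eq)) fixed))

  infix 4 _≟ˢ_
  _≟ˢ_ : DecidableEquality (Subset N)
  _≟ˢ_ = Vec.≡-dec Bool._≟_

  stabilizer : Subset N → List X
  stabilizer U = filter (λ g → g • U ≟ˢ U) allElements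

  ∈-stabilizer⁺ : ∀ {g U} → g • U ≡ U → g ∈ stabilizer U
  ∈-stabilizer⁺ {g} {U} = ∈-filter⁺ (λ g → g • U ≟ˢ U) (∈-allElements g)

  ∈-stabilizer⁻ : ∀ {g U} → g ∈ stabilizer U → g • U ≡ U
  ∈-stabilizer⁻ {U = U} = proj₂ ∘ ∈-filter⁻ (λ g → g • U ≟ˢ U) {xs = allElements}

  stabilizer-unique : ∀ U → Unique (stabilizer U)
  stabilizer-unique U = Unique.filter⁺ (λ g → g • U ≟ˢ U) allElements-unique

  stabilizer-∙ : ∀ {U g h} → g ∈ stabilizer U → h ∈ stabilizer U → g ∙ h ∈ stabilizer U
  stabilizer-∙ {U} {g} {h} g∈ h∈ =
    ∈-stabilizer⁺ (trans (•-∙ g h U) (trans (cong (g •_) (∈-stabilizer⁻ h∈)) (∈-stabilizer⁻ g∈)))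

  length-stabilizer≤ : ∀ U → 0 < ∣ U ∣ → length (stabilizer U) ≤ ∣ U ∣
  length-stabilizer≤ U 0<∣U∣ with i , i∈U ← ∃-∈-members U 0<∣U∣ =
    subst (length (stabilizer U) ≤_) (length-members U)
      (injective⇒length≤ Fin._≟_ (λ g → to (g ∙ from i))
        (λ same → ∙-cancelʳ (from i) _ _ (to-injective same)) (stabilizer-unique U) lands)
    where
    lands : ∀ {g} → g ∈ stabilizer U → to (g ∙ from i) ∈ members U
    lands {g} g∈ = ∈-members⁺ U (begin
      lookup U (to (g ∙ from i))           ≡⟨ cong (λ V → lookup V (to (g ∙ from i))) (∈-stabilizer⁻ g∈) ⟨
      lookup (g • U) (to (g ∙ from i))     ≡⟨ lookup-• g U (g ∙ from i) ⟩
      lookup U (to (g ⁻¹ ∙ (g ∙ from i)))  ≡⟨ cong (lookup U ∘ to) (\\-leftDividesʳ g (from i)) ⟩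
      lookup U (to (from i))               ≡⟨ cong (lookup U) (strictlyInverseˡ i) ⟩
      lookup U i                           ≡⟨ ∈-members⁻ U i∈U ⟩
      true                                 ∎)

  conjugate-∈-stabilizer : ∀ {t g U} → t • g • U ≡ g • U → g ⁻¹ ∙ (t ∙ g) ∈ stabilizer U
  conjugate-∈-stabilizer {t} {g} {U} fixed = ∈-stabilizer⁺ (begin
    (g ⁻¹ ∙ (t ∙ g)) • U  ≡⟨ •-∙ (g ⁻¹) (t ∙ g) U ⟩
    g ⁻¹ • (t ∙ g) • U    ≡⟨ cong (g ⁻¹ •_) (•-∙ t g U) ⟩
    g ⁻¹ • t • g • U      ≡⟨ cong (g ⁻¹ •_) fixed ⟩
    g ⁻¹ • g • U          ≡⟨ ⁻¹-•-• g U ⟩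
    U                     ∎)

  open OrbitsOfInvolutions _≟ˢ_ _•_ •-∙ ε-• using (involutionsFixOrbitPoints)

  •-subsetsOfSize : ∀ {s} g {U} → U ∈ subsetsOfSize N s → g • U ∈ subsetsOfSize N s
  •-subsetsOfSize g {U = U} U∈Ω = ∈-subsetsOfSize⁺ (g • U) (trans (∣•∣ g U) (∈-subsetsOfSize⁻ U∈Ω))

  involutionsConjugateIntoSmallStabilizer : ∀ a m → N ≡ 2 ^ a * m → parity m ≡ 1ℙ →
    ∃[ U ] length (stabilizer U) ≤ 2 ^ a × (∀ t → t ∙ t ≡ ε → ∃[ g ] g ⁻¹ ∙ (t ∙ g) ∈ stabilizer U)
  involutionsConjugateIntoSmallStabilizer a m refl m-odd
    with U , U∈Ω , fixes ← involutionsFixOrbitPoints (subsetsOfSize-unique N (2 ^ a)) •-subsetsOfSize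
                             (trans (parity-length-subsetsOfSize a m) m-odd)
    with ∣U∣≡2^a ← ∈-subsetsOfSize⁻ U∈Ω =
    U , subst (length (stabilizer U) ≤_) ∣U∣≡2^a (length-stabilizer≤ U (subst (0 <_) (sym ∣U∣≡2^a) (m^n>0 2 a))) ,
    λ t t∙t≡ε → let g , fixed = fixes t t∙t≡ε in g , conjugate-∈-stabilizer fixed

  module _ (χ : X → Bool) (χ-∙ : ∀ g h → χ (g ∙ h) ≡ χ g xor χ h) where

    2*length-χ-true≤length : ∀ {P} → Unique P → (∀ {g h} → g ∈ P → h ∈ P → g ∙ h ∈ P) →
      2 * length (filter (λ g → χ g Bool.≟ true) P) ≤ length P
    2*length-χ-true≤length {P} P-unique P-closed with filter (λ g → χ g Bool.≟ true) P in odd≡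
    ... | []       = z≤n
    ... | p ∷ rest = subst (_≤ length P) doubled
      (injective⇒length≤ _≟_ id id (Unique.++⁺ odd-unique (Unique.map⁺ (∙-cancelˡ p _ _) odd-unique) disjoint) ⊆P)
      where
      Odd = p ∷ rest
      odd⁻ : ∀ {g} → g ∈ Odd → g ∈ P × χ g ≡ true
      odd⁻ g∈ = ∈-filter⁻ (λ g → χ g Bool.≟ true) (subst (_ ∈_) (sym odd≡) g∈)
      odd-unique : Unique Odd
      odd-unique = subst Unique odd≡ (Unique.filter⁺ (λ g → χ g Bool.≟ true) P-unique)
      disjoint : Disjoint Odd (map (p ∙_) Odd)
      disjoint (g∈ , g∈p∙) with h , h∈ , refl ← ∈-map⁻ (p ∙_) g∈p∙ =
        contradiction (trans (sym (proj₂ (odd⁻ g∈))) (trans (χ-∙ p h)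
          (cong₂ _xor_ (proj₂ (odd⁻ (here refl))) (proj₂ (odd⁻ h∈))))) λ ()
      ⊆P : ∀ {g} → g ∈ Odd ++ map (p ∙_) Odd → g ∈ P
      ⊆P g∈ with ∈-++⁻ Odd g∈
      ... | inj₁ g∈Odd = proj₁ (odd⁻ g∈Odd)
      ... | inj₂ g∈p∙  with h , h∈ , refl ← ∈-map⁻ (p ∙_) g∈p∙ =
        P-closed (proj₁ (odd⁻ (here refl))) (proj₁ (odd⁻ h∈))
      doubled : length (Odd ++ map (p ∙_) Odd) ≡ 2 * length Odd
      doubled = trans (length-++ Odd)
        (cong (length Odd +_) (trans (length-map (p ∙_) Odd) (sym (+-identityʳ (length Odd)))))

-- The semidirect product H ⋊ ℤ₂

module SemidirectProduct {n : ℕ} (H : FinGroup n) (σ : Fin n → Fin n)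
  (σ-automorphism : IsAutomorphism H σ) (σ-involutive : ∀ h → σ (σ h) ≡ h) where

  open FinGroup H
  open IsGroup isGroup using (assoc; identityˡ; identityʳ; inverseˡ; inverseʳ)
  open GroupMorphisms.IsGroupIsomorphism σ-automorphism using (∙-homo; ε-homo)
  open SemidirectZ2 H σ hiding (GTF)

  σ^-homo : ∀ a x y → σ^ a (x ∙ y) ≡ σ^ a x ∙ σ^ a y
  σ^-homo false x y = refl
  σ^-homo true  x y = ∙-homo x y

  σ^-ε : ∀ a → σ^ a ε ≡ ε
  σ^-ε false = refl
  σ^-ε true  = ε-homo

  σ^-σ^ : ∀ a b x → σ^ a (σ^ b x) ≡ σ^ (a xor b) x
  σ^-σ^ false b     x = refl
  σ^-σ^ true  false x = refl
  σ^-σ^ true  true  x = σ-involutive x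

  ·-assoc : ∀ g h k → (g · h) · k ≡ g · (h · k)
  ·-assoc (h₁ , a) (h₂ , b) (h₃ , c) = cong₂ _,_ (begin
    (h₁ ∙ σ^ a h₂) ∙ σ^ (a xor b) h₃      ≡⟨ assoc h₁ (σ^ a h₂) _ ⟩
    h₁ ∙ (σ^ a h₂ ∙ σ^ (a xor b) h₃)      ≡⟨ cong (λ x → h₁ ∙ (σ^ a h₂ ∙ x)) (σ^-σ^ a b h₃) ⟨
    h₁ ∙ (σ^ a h₂ ∙ σ^ a (σ^ b h₃))       ≡⟨ cong (h₁ ∙_) (σ^-homo a h₂ (σ^ b h₃)) ⟨
    h₁ ∙ σ^ a (h₂ ∙ σ^ b h₃)              ∎) (Bool.xor-assoc a b c)

  ·-identityˡ : ∀ g → e · g ≡ g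
  ·-identityˡ (h , b) = cong (_, b) (identityˡ h)

  ·-identityʳ : ∀ g → g · e ≡ g
  ·-identityʳ (h , a) = cong₂ _,_ (trans (cong (h ∙_) (σ^-ε a)) (identityʳ h)) (Bool.xor-identityʳ a)

  inv-inverseˡ : ∀ g → inv g · g ≡ e
  inv-inverseˡ (h , a) = cong₂ _,_
    (trans (sym (σ^-homo a (h ⁻¹) h)) (trans (cong (σ^ a) (inverseˡ h)) (σ^-ε a)))
    (Bool.xor-same a)

  inv-inverseʳ : ∀ g → g · inv g ≡ e
  inv-inverseʳ (h , a) = cong₂ _,_
    (trans (cong (h ∙_) (trans (σ^-σ^ a a (h ⁻¹)) (cong (λ b → σ^ b (h ⁻¹)) (Bool.xor-same a)))) (inverseʳ h))
    (Bool.xor-same a)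

  semidirect-isGroup : IsGroup _≡_ _·_ e inv
  semidirect-isGroup = record
    { isMonoid = record
      { isSemigroup = record
        { isMagma = record { isEquivalence = isEquivalence ; ∙-cong = cong₂ _·_ }
        ; assoc   = ·-assoc
        }
      ; identity = ·-identityˡ , ·-identityʳ
      }
    ; inverse = inv-inverseˡ , inv-inverseʳ
    ; ⁻¹-cong = cong inv
    }

  enumeration : SD ↔ Fin (n * 2)
  enumeration = ↔-sym ((↔-id (Fin n) ×-↔ Fin.2↔Bool) ↔-∘ Fin.*↔×)

  open FiniteGroup semidirect-isGroup _≟_ enumeration
    using (conjugate-sym; conjugate-trans; conjugate-⁻¹∙∙; stabilizer; stabilizer-unique; stabilizer-∙;
           involutionsConjugateIntoSmallStabilizer; 2*length-χ-true≤length)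

  anyConj-false⇒nonconjugate : ∀ g rs → anyConj g rs ≡ false → All (λ r → ¬ Conj r g) rs
  anyConj-false⇒nonconjugate g []       _    = []
  anyConj-false⇒nonconjugate g (r ∷ rs) none with conj? r g
  anyConj-false⇒nonconjugate g (r ∷ rs) () | yes _
  ... | no ¬r∼g = ¬r∼g ∷ anyConj-false⇒nonconjugate g rs none

  reps-⊆ : ∀ gs → reps gs ⊆ gs
  reps-⊆ (g ∷ gs) r∈ with anyConj g (reps gs)
  ... | true = there (reps-⊆ gs r∈)
  reps-⊆ (g ∷ gs) (here refl) | false = here refl
  reps-⊆ (g ∷ gs) (there r∈)  | false = there (reps-⊆ gs r∈)

  reps-nonconjugate : ∀ gs → AllPairs (λ r r′ → ¬ Conj r′ r) (reps gs)
  reps-nonconjugate []       = []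
  reps-nonconjugate (g ∷ gs) with anyConj g (reps gs) in none
  ... | true  = reps-nonconjugate gs
  ... | false = anyConj-false⇒nonconjugate g (reps gs) none ∷ reps-nonconjugate gs

  proj₂-conjugate : ∀ g t → proj₂ (inv g · (t · g)) ≡ proj₂ t
  proj₂-conjugate (_ , a) (_ , b) with a | b
  ... | false | false = refl
  ... | false | true  = refl
  ... | true  | false = refl
  ... | true  | true  = refl

  GTF≤2^k : ∀ k m → ¬ 2 ∣ m → n ≡ 2 ^ k * m → GTF H σ ≤ 2 ^ k
  GTF≤2^k k m 2∤m refl
    with U , P-small , captures ← involutionsConjugateIntoSmallStabilizer (suc k) m
           (trans (*-comm (2 ^ k * m) 2) (sym (*-assoc 2 (2 ^ k) m))) (¬2∣⇒parity≡1ℙ m 2∤m) =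
    ≤-trans (injectiveRel⇒length≤ _≟_ (λ r y → Conj y r) pairwise meets) (*-cancelˡ-≤ 2 (≤-trans
      (2*length-χ-true≤length proj₂ (λ _ _ → refl) (stabilizer-unique U) stabilizer-∙) P-small))
    where
    pairwise : AllPairs (λ r r′ → ∀ {y} → Conj y r → Conj y r′ → ⊥) (reps (filter inS? elements))
    pairwise = AllPairs.map (λ ¬r′∼r {y} y∼r y∼r′ → ¬r′∼r (conjugate-trans (conjugate-sym y∼r′) y∼r))
                            (reps-nonconjugate (filter inS? elements))
    meets : ∀ {r} → r ∈ reps (filter inS? elements) →
      ∃[ y ] y ∈ filter (λ g → proj₂ g Bool.≟ true) (stabilizer U) × Conj y r
    meets {r} r∈ with outside , involution ← proj₂ (∈-filter⁻ inS? {xs = elements} (reps-⊆ _ r∈))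
                 with g , g⁻¹rg∈P ← captures r involution =
      inv g · (r · g) , ∈-filter⁺ (λ g → proj₂ g Bool.≟ true) g⁻¹rg∈P (trans (proj₂-conjugate g r) outside) ,
      conjugate-⁻¹∙∙ g r

corollary10p2 : (n : ℕ) (H : FinGroup n) (σ : Fin n → Fin n) →
    IsAutomorphism H σ → (∀ h → σ (σ h) ≡ h) →
    (k m : ℕ) → ¬ (2 ∣ m) → n ≡ 2 ^ k * m →
    GTF H σ ≤ 2 ^ k
corollary10p2 n H σ σ-automorphism σ-involutive =
  SemidirectProduct.GTF≤2^k H σ σ-automorphism σ-involutive
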